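{- Let $(G,\rho)$ be a P-framework, let $u,v\in V_G$, and let $W,W'$ be walks from $u$ to $v$ in $G$. If $G$ has a cartesian NAC-coloring $\delta$ and $c\in\{\text{red},\text{blue}\}$, then $$\sum_{\substack{\overrightarrow{w_1w_2}\in W\\ \delta(w_1w_2)=c}}\bigl(\rho(w_2)-\rho(w_1)\bigr)=\sum_{\substack{\overrightarrow{w_1w_2}\in W'\\ \delta(w_1w_2)=c}}\bigl(\rho(w_2)-\rho(w_1)\bigr).$$
   Context: For a graph $G$, two edges are related if they are opposite edges of a 4-cycle subgraph of $G$; a ribbon is an equivalence class of the reflexive–transitive closure of this relation. A ribbon-cutting graph is a connected graph in which every ribbon is an edge cut (its removal disconnects the graph). A parallelogram placement of a connected graph $G$ is an injective map $\rho:V_G\to\mathbb{R}^2$ such that every 4-cycle $(u_1,u_2,u_3,u_4)$ of $G$ satisfies $\rho(u_2)-\rho(u_1)=\rho(u_3)-\rho(u_4)$. A P-framework is a pair $(G,\rho)$ with $G$ ribbon-cutting and $\rho$ a parallelogram placement. A NAC-coloring of $G$ is a surjective map $\delta:E_G\to\{\text{red},\text{blue}\}$ such that every cycle is monochromatic or contains at least two edges of each color; it is cartesian if no two distinct vertices are connected by both a red path and a blue path. Notation: $\overrightarrow{w_1w_2}\in W$ means $w_1w_2$ is an edge of $W$ traversed with $w_1$ preceding $w_2$; sums run over the edges of the walk as a multiset, each traversal counted. -}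

module Defs where

open import Level using (Level; _⊔_)
open import Data.Nat using (ℕ; zero; suc; _≤_; _+_)
open import Data.Fin using (Fin)
open import Data.Bool using (Bool; true; false)
open import Data.List using (List; []; _∷_; length)
open import Data.List.Relation.Unary.All using (All)
open import Data.List.Relation.Unary.Unique.Propositional using (Unique)
open import Data.Product using (Σ; ∃; ∃-syntax; _×_; _,_)
open import Data.Sum using (_⊎_)
open import Relation.Nullary using (¬_)
open import Relation.Binary.PropositionalEquality using (_≡_; _≢_)
open import Relation.Binary.Construct.Closure.ReflexiveTransitive using (Star)
open import Function.Definitions using (Injective)
open import Algebra.Bundles using (AbelianGroup)

record Graph (n : ℕ) : Set where
  field
    E     : Fin n → Fin n → Bool
    sym   : ∀ u v → E u v ≡ E v u
    irrefl : ∀ u → E u u ≡ false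
open Graph public

Adj : ∀ {n} → Graph n → Fin n → Fin n → Set
Adj G u v = E G u v ≡ true

data Walk {n : ℕ} (R : Fin n → Fin n → Set) : Fin n → Fin n → Set where
  nil  : ∀ {u} → Walk R u u
  cons : ∀ {u w v} → R u w → Walk R w v → Walk R u v

verts : ∀ {n} {R : Fin n → Fin n → Set} {u v} → Walk R u v → List (Fin n)
verts {u = u} nil = u ∷ []
verts {u = u} (cons _ W) = u ∷ verts W

dedges : ∀ {n} {R : Fin n → Fin n → Set} {u v} → Walk R u v → List (Fin n × Fin n)
dedges nil = []
dedges {u = u} (cons {w = w} _ W) = (u , w) ∷ dedges W

IsPath : ∀ {n} {R : Fin n → Fin n → Set} {u v} → Walk R u v → Set
IsPath W = Unique (verts W)

Connected : ∀ {n} → Graph n → Set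
Connected G = ∀ u v → Walk (Adj G) u v

Is4Cycle : ∀ {n} → Graph n → Fin n → Fin n → Fin n → Fin n → Set
Is4Cycle G u1 u2 u3 u4 =
  Unique (u1 ∷ u2 ∷ u3 ∷ u4 ∷ []) ×
  Adj G u1 u2 × Adj G u2 u3 × Adj G u3 u4 × Adj G u4 u1

DEdge : ℕ → Set
DEdge n = Fin n × Fin n

-- Edges are represented by ordered pairs; an unordered edge uv corresponds
-- to both (u,v) and (v,u).
data RibbonStep {n : ℕ} (G : Graph n) : DEdge n → DEdge n → Set where
  flip : ∀ {a b} → RibbonStep G (a , b) (b , a)
  opp  : ∀ {u1 u2 u3 u4} → Is4Cycle G u1 u2 u3 u4 →
         RibbonStep G (u1 , u2) (u4 , u3)

-- same ribbon (reflexive–transitive closure; the step relation is symmetric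
-- up to rotation/reflection of 4-cycles and flipping)
SameRibbon : ∀ {n} → Graph n → DEdge n → DEdge n → Set
SameRibbon G = Star (RibbonStep G)

AdjMinusRibbon : ∀ {n} → Graph n → Fin n → Fin n → Fin n → Fin n → Set
AdjMinusRibbon G a b c d = Adj G c d × ¬ SameRibbon G (a , b) (c , d)

RibbonCutting : ∀ {n} → Graph n → Set
RibbonCutting G =
  Connected G ×
  (∀ a b → Adj G a b →
     ∃[ x ] ∃[ y ] ¬ Walk (AdjMinusRibbon G a b) x y)

-- Plane A × A over an abelian group A (stand-in for ℝ²)

module Plane {a ℓ : Level} (A : AbelianGroup a ℓ) where
  open AbelianGroup A

  Pt : Set a
  Pt = Carrier × Carrier

  _≋_ : Pt → Pt → Set ℓ
  (x , y) ≋ (x' , y') = (x ≈ x') × (y ≈ y')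

  _⊕_ : Pt → Pt → Pt
  (x , y) ⊕ (x' , y') = (x ∙ x') , (y ∙ y')

  _⊖_ : Pt → Pt → Pt
  (x , y) ⊖ (x' , y') = (x ∙ (x' ⁻¹)) , (y ∙ (y' ⁻¹))

  𝟘 : Pt
  𝟘 = ε , ε

open Plane public

ParallelogramPlacement : ∀ {a ℓ n} (A : AbelianGroup a ℓ) → Graph n →
                         (Fin n → Pt A) → Set ℓ
ParallelogramPlacement A G ρ =
  Injective (_≡_) (_≋_ A) ρ ×
  (∀ u1 u2 u3 u4 → Is4Cycle G u1 u2 u3 u4 →
     _≋_ A (_⊖_ A (ρ u2) (ρ u1)) (_⊖_ A (ρ u3) (ρ u4)))

data Color : Set where
  red blue : Color

_==ᶜ_ : Color → Color → Bool
red  ==ᶜ red  = true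
blue ==ᶜ blue = true
_    ==ᶜ _    = false

-- edge colorings: a color for every ordered pair, required to be symmetric
-- on edges (so it is a coloring of unordered edges)
record EdgeColoring {n : ℕ} (G : Graph n) : Set where
  field
    col    : Fin n → Fin n → Color
    colSym : ∀ u v → Adj G u v → col u v ≡ col v u
open EdgeColoring public

cycEdgesAux : ∀ {n} → Fin n → List (Fin n) → List (DEdge n)
cycEdgesAux x₀ [] = []
cycEdgesAux x₀ (x ∷ []) = (x , x₀) ∷ []
cycEdgesAux x₀ (x ∷ y ∷ zs) = (x , y) ∷ cycEdgesAux x₀ (y ∷ zs)

cycEdges : ∀ {n} → List (Fin n) → List (DEdge n)
cycEdges [] = []
cycEdges (x ∷ xs) = cycEdgesAux x (x ∷ xs)

IsCycle : ∀ {n} → Graph n → List (Fin n) → Set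
IsCycle G vs = 3 ≤ length vs × Unique vs ×
               All (λ e → Adj G (Data.Product.proj₁ e) (Data.Product.proj₂ e)) (cycEdges vs)

countColor : ∀ {n} → (Fin n → Fin n → Color) → Color → List (DEdge n) → ℕ
countColor δ c [] = 0
countColor δ c ((u , v) ∷ es) with δ u v ==ᶜ c
... | true  = suc (countColor δ c es)
... | false = countColor δ c es

IsNAC : ∀ {n} (G : Graph n) → EdgeColoring G → Set
IsNAC G δ =
  (∃[ u ] ∃[ v ] Adj G u v × col δ u v ≡ red) ×
  (∃[ u ] ∃[ v ] Adj G u v × col δ u v ≡ blue) ×
  (∀ vs → IsCycle G vs →
     (∃[ c ] All (λ e → col δ (Data.Product.proj₁ e) (Data.Product.proj₂ e) ≡ c) (cycEdges vs))
     ⊎ (2 ≤ countColor (col δ) red (cycEdges vs) × 2 ≤ countColor (col δ) blue (cycEdges vs)))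

AdjCol : ∀ {n} (G : Graph n) → EdgeColoring G → Color → Fin n → Fin n → Set
AdjCol G δ c u v = Adj G u v × col δ u v ≡ c

IsCartesian : ∀ {n} (G : Graph n) → EdgeColoring G → Set
IsCartesian G δ =
  ∀ u v → u ≢ v →
    ¬ ((Σ (Walk (AdjCol G δ red) u v) IsPath) × (Σ (Walk (AdjCol G δ blue) u v) IsPath))

colSum : ∀ {a ℓ n} (A : AbelianGroup a ℓ) → (Fin n → Pt A) →
         (Fin n → Fin n → Color) → Color → List (DEdge n) → Pt A
colSum A ρ δ c [] = 𝟘 A
colSum A ρ δ c ((w₁ , w₂) ∷ es) with δ w₁ w₂ ==ᶜ c
... | true  = _⊕_ A (_⊖_ A (ρ w₂) (ρ w₁)) (colSum A ρ δ c es)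
... | false = colSum A ρ δ c es

module Submission where

-- Plan.  (1) Module Ribbon: fix an edge ab.  Every edge of its ribbon is a
-- translate of ab, and, ρ being injective, two adjacent sides of a 4-cycle never
-- share a ribbon; so each ribbon edge joins the a-side to the b-side of G with
-- the ribbon removed.  As the ribbon is a cut, a and b lie on different sides,
-- and the ribbon edges of any walk from u to v contribute exactly φ(v) - φ(u),
-- where φ is ρ(a) on the a-side and ρ(b) on the b-side.
-- (2) Module UnionsOfRibbons: for any union of ribbons the sum is therefore
-- walk-independent, by peeling off one ribbon at a time.
-- (3) Module CartesianNAC: a cartesian NAC-colouring gives opposite sides of a
-- 4-cycle the same colour, so each colour class is a union of ribbons.

open import Defs
open import Level using (Level)
open import Data.Nat using (ℕ; suc; _≤_; _<_; s≤s; z≤n)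
open import Data.Nat.Properties using (≤-pred; <-≤-trans; m≤n⇒m≤1+n; n<1+n)
open import Data.Fin using (Fin)
import Data.Fin.Properties as Fin
open import Data.Bool using (Bool; true; false; _∧_; not) renaming (_≟_ to _≟ᵇ_)
open import Data.List using (List; []; _∷_; map; allFin; cartesianProduct)
open import Data.List.Membership.Propositional using (_∈_)
open import Data.List.Membership.Propositional.Properties using (∈-cartesianProduct⁺; ∈-allFin)
open import Data.List.Relation.Unary.Any using (here; there)
open import Data.List.Relation.Unary.All using ([]; _∷_)
open import Data.List.Relation.Unary.AllPairs using ([]; _∷_)
open import Data.List.Relation.Unary.Unique.Propositional using (Unique)
open import Data.Product using (∃-syntax; _×_; _,_; proj₁; proj₂; swap)
import Data.Product.Properties as Product
open import Data.Sum using (_⊎_; inj₁; inj₂; [_,_])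
open import Function using (id)
open import Data.Empty using (⊥-elim)
open import Relation.Nullary using (¬_; Dec; yes; no)
open import Relation.Nullary.Decidable using (_×-dec_; _⊎-dec_; map′; isYes)
open import Relation.Binary.Definitions using (DecidableEquality)
open import Relation.Binary.PropositionalEquality
  using (_≡_; _≢_; refl; cong; cong₂; subst; ≢-sym) renaming (sym to ≡-sym; trans to ≡-trans)
open import Relation.Binary.Construct.Closure.ReflexiveTransitive
  using (Star; _◅_; _◅◅_) renaming (ε to ε★)
open import Algebra.Bundles using (AbelianGroup)
open import Algebra.Construct.DirectProduct using (abelianGroup)

module Differences {g ℓ : Level} (P : AbelianGroup g ℓ) where
  open AbelianGroup P renaming (sym to ≈-sym)
  open import Algebra.Properties.AbelianGroup P using (⁻¹-anti-homo-//; //-rightDividesˡ)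
  open import Relation.Binary.Reasoning.Setoid setoid

  telescope : ∀ x y z → (y ∙ z ⁻¹) ∙ (x ∙ y ⁻¹) ≈ x ∙ z ⁻¹
  telescope x y z = begin
    (y ∙ z ⁻¹) ∙ (x ∙ y ⁻¹) ≈⟨ comm _ _ ⟩
    (x ∙ y ⁻¹) ∙ (y ∙ z ⁻¹) ≈⟨ assoc _ _ _ ⟩
    x ∙ (y ⁻¹ ∙ (y ∙ z ⁻¹)) ≈⟨ ∙-congˡ (≈-sym (assoc _ _ _)) ⟩
    x ∙ ((y ⁻¹ ∙ y) ∙ z ⁻¹) ≈⟨ ∙-congˡ (∙-congʳ (inverseˡ y)) ⟩
    x ∙ (ε ∙ z ⁻¹)          ≈⟨ ∙-congˡ (identityˡ _) ⟩
    x ∙ z ⁻¹                ∎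

  difference-swap : ∀ {x y p q} → x ∙ y ⁻¹ ≈ p ∙ q ⁻¹ → y ∙ x ⁻¹ ≈ q ∙ p ⁻¹
  difference-swap {x} {y} {p} {q} eq = begin
    y ∙ x ⁻¹      ≈⟨ ≈-sym (⁻¹-anti-homo-// x y) ⟩
    (x ∙ y ⁻¹) ⁻¹ ≈⟨ ⁻¹-cong eq ⟩
    (p ∙ q ⁻¹) ⁻¹ ≈⟨ ⁻¹-anti-homo-// p q ⟩
    q ∙ p ⁻¹      ∎

  difference-cancelʳ : ∀ {x y z} → x ∙ z ⁻¹ ≈ y ∙ z ⁻¹ → x ≈ y
  difference-cancelʳ {x} {y} {z} eq = begin
    x                ≈⟨ ≈-sym (//-rightDividesˡ z x) ⟩
    (x ∙ z ⁻¹) ∙ z   ≈⟨ ∙-congʳ eq ⟩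
    (y ∙ z ⁻¹) ∙ z   ≈⟨ //-rightDividesˡ z y ⟩
    y                ∎

-- Paths are built Floyd–Warshall style: 'Via L x y'
-- are paths whose intermediate vertices all lie in L, and allowing one more
-- intermediate vertex z only adds paths that pass through z.
module Reachability {X : Set} (_≟_ : DecidableEquality X)
                    {R : X → X → Set} (R? : ∀ x y → Dec (R x y))
                    (vertices : List X) (complete : ∀ x → x ∈ vertices) where

  data Via (L : List X) : X → X → Set where
    stay : ∀ {x} → Via L x x
    edge : ∀ {x y} → R x y → Via L x y
    join : ∀ {x z y} → Via L x z → z ∈ L → Via L z y → Via L x y

  widen : ∀ {z L x y} → Via L x y → Via (z ∷ L) x y
  widen stay         = stay
  widen (edge r)     = edge r
  widen (join p m q) = join (widen p) (there m) (widen q)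

  split : ∀ {z L x y} → Via (z ∷ L) x y → Via L x y ⊎ (Via L x z × Via L z y)
  split stay     = inj₁ stay
  split (edge r) = inj₁ (edge r)
  split (join p (here refl) q) = inj₂ ([ id , proj₁ ] (split p) , [ id , proj₂ ] (split q))
  split (join p (there m) q) with split p | split q
  ... | inj₁ p′        | inj₁ q′        = inj₁ (join p′ m q′)
  ... | inj₁ p′        | inj₂ (q₁ , q₂) = inj₂ (join p′ m q₁ , q₂)
  ... | inj₂ (p₁ , p₂) | inj₁ q′        = inj₂ (p₁ , join p₂ m q′)
  ... | inj₂ (p₁ , _)  | inj₂ (_ , q₂)  = inj₂ (p₁ , q₂)

  via? : ∀ L x y → Dec (Via L x y)
  via? [] x y = map′ direct undirect ((x ≟ y) ⊎-dec R? x y)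
    where
      direct : x ≡ y ⊎ R x y → Via [] x y
      direct (inj₁ refl) = stay
      direct (inj₂ r)    = edge r
      undirect : Via [] x y → x ≡ y ⊎ R x y
      undirect stay       = inj₁ refl
      undirect (edge r)   = inj₂ r
      undirect (join _ () _)
  via? (z ∷ L) x y = map′ combine split (via? L x y ⊎-dec (via? L x z ×-dec via? L z y))
    where
      combine : Via L x y ⊎ (Via L x z × Via L z y) → Via (z ∷ L) x y
      combine (inj₁ p)       = widen p
      combine (inj₂ (p , q)) = join (widen p) (here refl) (widen q)

  toStar : ∀ {L x y} → Via L x y → Star R x y
  toStar stay         = ε★
  toStar (edge r)     = r ◅ ε★
  toStar (join p _ q) = toStar p ◅◅ toStar q

  fromStar : ∀ {x y} → Star R x y → Via vertices x y
  fromStar ε★      = stay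
  fromStar (r ◅ s) = join (edge r) (complete _) (fromStar s)

  star? : ∀ x y → Dec (Star R x y)
  star? x y = map′ toStar fromStar (via? vertices x y)

module _ {n : ℕ} where

  _++ʷ_ : ∀ {R : Fin n → Fin n → Set} {x y z} → Walk R x y → Walk R y z → Walk R x z
  nil       ++ʷ W′ = W′
  cons r W ++ʷ W′ = cons r (W ++ʷ W′)

  _▸_ : ∀ {R : Fin n → Fin n → Set} {x y z} → Walk R x y → R y z → Walk R x z
  W ▸ r = W ++ʷ cons r nil

  reverseʷ : ∀ {R : Fin n → Fin n → Set} → (∀ {x y} → R x y → R y x) →
             ∀ {x y} → Walk R x y → Walk R y x
  reverseʷ sym nil        = nil
  reverseʷ sym (cons r W) = reverseʷ sym W ▸ sym r

  expandʷ : ∀ {R S : Fin n → Fin n → Set} → (∀ {x y} → R x y → Walk S x y) →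
            ∀ {x y} → Walk R x y → Walk S x y
  expandʷ sub nil        = nil
  expandʷ sub (cons r W) = sub r ++ʷ expandʷ sub W

  transportʷ : ∀ {R : Fin n → Fin n → Set} {p} (Q : Fin n → Set p) →
               (∀ {x y} → R x y → Q x → Q y) →
               ∀ {x y} → Walk R x y → Q x → Q y
  transportʷ Q step nil        q = q
  transportʷ Q step (cons r W) q = transportʷ Q step W (step r q)

reachable-induction : ∀ {X : Set} {R : X → X → Set} {p} {r : X} (Q : X → Set p) →
                      (∀ {x y} → Star R r x → R x y → Q x → Q y) →
                      Q r → ∀ {y} → Star R r y → Q y
reachable-induction {R = R} {r = r} Q step qr = go ε★ qr
  where
    go : ∀ {x y} → Star R r x → Q x → Star R x y → Q y
    go reach q ε★      = q
    go reach q (s ◅ t) = go (reach ◅◅ (s ◅ ε★)) (step reach s q) t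

module _ {n : ℕ} (G : Graph n) where

  adj-sym : ∀ {u v} → Adj G u v → Adj G v u
  adj-sym {u} {v} uv = ≡-trans (Graph.sym G v u) uv

  IsEdge : DEdge n → Set
  IsEdge (x , y) = Adj G x y

  reflect-4cycle : ∀ {u₁ u₂ u₃ u₄} → Is4Cycle G u₁ u₂ u₃ u₄ → Is4Cycle G u₄ u₃ u₂ u₁
  reflect-4cycle (((n₁₂ ∷ n₁₃ ∷ n₁₄ ∷ []) ∷ (n₂₃ ∷ n₂₄ ∷ []) ∷ (n₃₄ ∷ []) ∷ [] ∷ [])
                 , a₁₂ , a₂₃ , a₃₄ , a₄₁) =
    ((≢-sym n₃₄ ∷ ≢-sym n₂₄ ∷ ≢-sym n₁₄ ∷ []) ∷ (≢-sym n₂₃ ∷ ≢-sym n₁₃ ∷ [])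
      ∷ (≢-sym n₁₂ ∷ []) ∷ [] ∷ [])
    , adj-sym a₃₄ , adj-sym a₂₃ , adj-sym a₁₂ , adj-sym a₄₁

  rotate-4cycle : ∀ {u₁ u₂ u₃ u₄} → Is4Cycle G u₁ u₂ u₃ u₄ → Is4Cycle G u₂ u₃ u₄ u₁
  rotate-4cycle (((n₁₂ ∷ n₁₃ ∷ n₁₄ ∷ []) ∷ (n₂₃ ∷ n₂₄ ∷ []) ∷ (n₃₄ ∷ []) ∷ [] ∷ [])
                , a₁₂ , a₂₃ , a₃₄ , a₄₁) =
    ((n₂₃ ∷ n₂₄ ∷ ≢-sym n₁₂ ∷ []) ∷ (n₃₄ ∷ ≢-sym n₁₃ ∷ []) ∷ (≢-sym n₁₄ ∷ []) ∷ [] ∷ [])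
    , a₂₃ , a₃₄ , a₄₁ , a₁₂

  ribbonStep-sym : ∀ {e e′} → RibbonStep G e e′ → RibbonStep G e′ e
  ribbonStep-sym flip    = flip
  ribbonStep-sym (opp c) = opp (reflect-4cycle c)

  ribbonStep-edge : ∀ {e e′} → IsEdge e → RibbonStep G e e′ → IsEdge e′
  ribbonStep-edge uv flip                        = adj-sym uv
  ribbonStep-edge uv (opp (_ , _ , _ , a₃₄ , _)) = adj-sym a₃₄

  adj? : ∀ u v → Dec (Adj G u v)
  adj? u v = E G u v ≟ᵇ true

  is4Cycle? : ∀ u₁ u₂ u₃ u₄ → Dec (Is4Cycle G u₁ u₂ u₃ u₄)
  is4Cycle? u₁ u₂ u₃ u₄ = unique? (u₁ ∷ u₂ ∷ u₃ ∷ u₄ ∷ [])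
    ×-dec adj? u₁ u₂ ×-dec adj? u₂ u₃ ×-dec adj? u₃ u₄ ×-dec adj? u₄ u₁
    where open import Data.List.Relation.Unary.Unique.DecPropositional (Fin._≟_ {n}) using (unique?)

  ribbonStep? : ∀ e e′ → Dec (RibbonStep G e e′)
  ribbonStep? (p , q) (r , s) with is4Cycle? p q s r | r Fin.≟ q | s Fin.≟ p
  ... | yes c  | _        | _        = yes (opp c)
  ... | no ¬c  | yes refl | yes refl = yes flip
  ... | no ¬c  | no r≢q   | _        = no λ { flip → r≢q refl ; (opp c) → ¬c c }
  ... | no ¬c  | yes _    | no s≢p   = no λ { flip → s≢p refl ; (opp c) → ¬c c }

  pairs : List (DEdge n)
  pairs = cartesianProduct (allFin n) (allFin n)

  ∈-pairs : ∀ e → e ∈ pairs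
  ∈-pairs (x , y) = ∈-cartesianProduct⁺ (∈-allFin x) (∈-allFin y)

  sameRibbon? : ∀ e e′ → Dec (SameRibbon G e e′)
  sameRibbon? = Reachability.star? (Product.≡-dec Fin._≟_ Fin._≟_) ribbonStep? pairs ∈-pairs

  -- a selection of directed pairs that is a union of ribbons: it contains an
  -- edge exactly when it contains the edges related to it
  RibbonClosed : (DEdge n → Bool) → Set
  RibbonClosed f = ∀ {e e′} → IsEdge e → RibbonStep G e e′ → f e ≡ f e′

  closed-along : ∀ {f} → RibbonClosed f → ∀ {e e′} → IsEdge e → SameRibbon G e e′ → f e ≡ f e′
  closed-along {f} closed {e} e-edge s =
    proj₂ (reachable-induction (λ e′ → IsEdge e′ × f e ≡ f e′) step (e-edge , refl) s)
    where
      step : ∀ {d d′} → SameRibbon G e d → RibbonStep G d d′ →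
             IsEdge d × f e ≡ f d → IsEdge d′ × f e ≡ f d′
      step _ st (d-edge , eq) = ribbonStep-edge d-edge st , ≡-trans eq (closed d-edge st)

module _ {X : Set} where

  count : (X → Bool) → List X → ℕ
  count f []       = 0
  count f (e ∷ es) with f e
  ... | true  = suc (count f es)
  ... | false = count f es

  count-mono : ∀ (f g : X → Bool) → (∀ e → g e ≡ true → f e ≡ true) →
               ∀ es → count g es ≤ count f es
  count-mono f g g⊆f []       = z≤n
  count-mono f g g⊆f (e ∷ es) with g e in ge | f e in fe
  ... | true  | true  = s≤s (count-mono f g g⊆f es)
  ... | true  | false with () ← ≡-trans (≡-sym (g⊆f e ge)) fe
  ... | false | true  = m≤n⇒m≤1+n (count-mono f g g⊆f es)
  ... | false | false = count-mono f g g⊆f es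

  count-strict : ∀ (f g : X → Bool) → (∀ e → g e ≡ true → f e ≡ true) →
                 ∀ {d es} → d ∈ es → f d ≡ true → g d ≡ false → count g es < count f es
  count-strict f g g⊆f {es = e ∷ es} (here refl) fd gd rewrite fd | gd =
    s≤s (count-mono f g g⊆f es)
  count-strict f g g⊆f {es = e ∷ es} (there d∈es) fd gd with g e in ge | f e in fe
  ... | true  | true  = s≤s (count-strict f g g⊆f d∈es fd gd)
  ... | true  | false with () ← ≡-trans (≡-sym (g⊆f e ge)) fe
  ... | false | true  = m≤n⇒m≤1+n (count-strict f g g⊆f d∈es fd gd)
  ... | false | false = count-strict f g g⊆f d∈es fd gd

module EdgeSums {a ℓ : Level} (A : AbelianGroup a ℓ) {n : ℕ} (ρ : Fin n → Pt A) where

  open AbelianGroup (abelianGroup A A)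
    renaming (refl to ≈-refl; sym to ≈-sym; trans to ≈-trans)
  open Differences (abelianGroup A A)
  open import Relation.Binary.Reasoning.Setoid setoid
  open import Algebra.Properties.CommutativeSemigroup commutativeSemigroup using (x∙yz≈y∙xz)

  disp : DEdge n → Pt A
  disp (x , y) = ρ y ∙ ρ x ⁻¹

  sumWhere : (DEdge n → Bool) → List (DEdge n) → Pt A
  sumWhere f []       = ε
  sumWhere f (e ∷ es) with f e
  ... | true  = disp e ∙ sumWhere f es
  ... | false = sumWhere f es

  colSum-sumWhere : ∀ (δ : Fin n → Fin n → Color) c es →
                    colSum A ρ δ c es ≡ sumWhere (λ (x , y) → δ x y ==ᶜ c) es
  colSum-sumWhere δ c []              = refl
  colSum-sumWhere δ c ((x , y) ∷ es) with δ x y ==ᶜ c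
  ... | true  = cong (disp (x , y) ∙_) (colSum-sumWhere δ c es)
  ... | false = colSum-sumWhere δ c es

  sumWhere-split : ∀ (f h : DEdge n → Bool) → (∀ e → h e ≡ true → f e ≡ true) → ∀ es →
                   sumWhere f es ≈ sumWhere h es ∙ sumWhere (λ e → f e ∧ not (h e)) es
  sumWhere-split f h h⊆f []       = ≈-sym (identityˡ ε)
  sumWhere-split f h h⊆f (e ∷ es) with f e in fe | h e in he
  ... | true  | true  = begin
    disp e ∙ sumWhere f es                           ≈⟨ ∙-congˡ (sumWhere-split f h h⊆f es) ⟩
    disp e ∙ (sumWhere h es ∙ sumWhere _ es)         ≈⟨ ≈-sym (assoc _ _ _) ⟩
    (disp e ∙ sumWhere h es) ∙ sumWhere _ es         ∎
  ... | true  | false = begin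
    disp e ∙ sumWhere f es                           ≈⟨ ∙-congˡ (sumWhere-split f h h⊆f es) ⟩
    disp e ∙ (sumWhere h es ∙ sumWhere _ es)         ≈⟨ x∙yz≈y∙xz _ _ _ ⟩
    sumWhere h es ∙ (disp e ∙ sumWhere _ es)         ∎
  ... | false | true  with () ← ≡-trans (≡-sym fe) (h⊆f e he)
  ... | false | false = sumWhere-split f h h⊆f es

  sumWhere-telescopes :
    ∀ {R : Fin n → Fin n → Set} (f : DEdge n → Bool) (φ : Fin n → Pt A) →
    (∀ {x y} → R x y → f (x , y) ≡ true → disp (x , y) ≈ φ y ∙ φ x ⁻¹) →
    (∀ {x y} → R x y → f (x , y) ≡ false → φ x ≈ φ y) →
    ∀ {u v} (W : Walk R u v) → sumWhere f (dedges W) ≈ φ v ∙ φ u ⁻¹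
  sumWhere-telescopes f φ increment constant {u} nil = ≈-sym (inverseʳ (φ u))
  sumWhere-telescopes f φ increment constant {u} {v} (cons {w = w} r W)
    with f (u , w) in fu
  ... | true  = begin
    disp (u , w) ∙ sumWhere f (dedges W) ≈⟨ ∙-cong (increment r fu) rest ⟩
    (φ w ∙ φ u ⁻¹) ∙ (φ v ∙ φ w ⁻¹)      ≈⟨ telescope (φ v) (φ w) (φ u) ⟩
    φ v ∙ φ u ⁻¹                         ∎
    where rest = sumWhere-telescopes f φ increment constant W
  ... | false = begin
    sumWhere f (dedges W)   ≈⟨ sumWhere-telescopes f φ increment constant W ⟩
    φ v ∙ φ w ⁻¹            ≈⟨ ∙-congˡ (⁻¹-cong (≈-sym (constant r fu))) ⟩
    φ v ∙ φ u ⁻¹            ∎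

-- Removing it leaves an a-side and
-- a b-side; every ribbon edge crosses from one to the other with displacement
-- ±(ρ b - ρ a), so summing over ribbon edges along a walk measures only which
-- sides the endpoints lie on.
module Ribbon {a ℓ : Level} (A : AbelianGroup a ℓ) {n : ℕ} (G : Graph n)
              (ρ : Fin n → Pt A) (cutting : RibbonCutting G)
              (placement : ParallelogramPlacement A G ρ)
              (a b : Fin n) (ab : Adj G a b) where

  open AbelianGroup (abelianGroup A A)
    renaming (refl to ≈-refl; sym to ≈-sym; trans to ≈-trans)
  open Differences (abelianGroup A A)
  open EdgeSums A ρ

  InRibbon : DEdge n → Set
  InRibbon = SameRibbon G (a , b)

  inRibbon? : DEdge n → Bool
  inRibbon? e = isYes (sameRibbon? G (a , b) e)

  Linked : Fin n → Fin n → Set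
  Linked = Walk (AdjMinusRibbon G a b)

  linked-sym : ∀ {x y} → Linked x y → Linked y x
  linked-sym = reverseʷ λ (xy , ∉) → adj-sym G xy , λ r → ∉ (r ◅◅ (flip ◅ ε★))

  parallelogram : ∀ {u₁ u₂ u₃ u₄} → Is4Cycle G u₁ u₂ u₃ u₄ → disp (u₁ , u₂) ≈ disp (u₄ , u₃)
  parallelogram c = proj₂ placement _ _ _ _ c

  parallelogram-swap : ∀ {u₁ u₂ u₃ u₄} → Is4Cycle G u₁ u₂ u₃ u₄ → disp (u₂ , u₁) ≈ disp (u₃ , u₄)
  parallelogram-swap c = difference-swap (parallelogram c)

  D : Pt A
  D = disp (a , b)

  ribbon-parallel : ∀ {e} → InRibbon e → disp e ≈ D ⊎ disp (swap e) ≈ D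
  ribbon-parallel = reachable-induction (λ e → disp e ≈ D ⊎ disp (swap e) ≈ D) step (inj₁ ≈-refl)
    where
      step : ∀ {e e′} → InRibbon e → RibbonStep G e e′ →
             disp e ≈ D ⊎ disp (swap e) ≈ D → disp e′ ≈ D ⊎ disp (swap e′) ≈ D
      step _ flip    (inj₁ p) = inj₂ p
      step _ flip    (inj₂ p) = inj₁ p
      step _ (opp c) (inj₁ p) = inj₁ (≈-trans (≈-sym (parallelogram c)) p)
      step _ (opp c) (inj₂ p) = inj₂ (≈-trans (≈-sym (parallelogram-swap c)) p)

  same-start : ∀ {x y z} → disp (x , y) ≈ disp (x , z) → y ≡ z
  same-start eq = proj₁ placement (difference-cancelʳ eq)

  same-end : ∀ {x y z} → disp (y , x) ≈ disp (z , x) → y ≡ z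
  same-end eq = proj₁ placement (difference-cancelʳ (difference-swap eq))

  adjacent-sides : ∀ {u₁ u₂ u₃ u₄} → Is4Cycle G u₁ u₂ u₃ u₄ →
                   InRibbon (u₁ , u₂) → ¬ InRibbon (u₁ , u₄)
  adjacent-sides c@(((_ ∷ n₁₃ ∷ _) ∷ (_ ∷ n₂₄ ∷ []) ∷ _) , _) s₁₂ s₁₄
    with ribbon-parallel s₁₂ | ribbon-parallel s₁₄
  ... | inj₁ p | inj₁ q = n₂₄ (same-start (≈-trans p (≈-sym q)))
  ... | inj₂ p | inj₂ q = n₂₄ (same-end (≈-trans p (≈-sym q)))
  ... | inj₁ p | inj₂ q =
    n₁₃ (≡-sym (same-start (≈-trans (≈-sym (parallelogram c)) (≈-trans p (≈-sym q)))))
  ... | inj₂ p | inj₁ q =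
    n₁₃ (≡-sym (same-end (≈-trans (≈-sym (parallelogram-swap c)) (≈-trans p (≈-sym q)))))

  beside-ribbon : ∀ {u₁ u₂ u₃ u₄} → Is4Cycle G u₁ u₂ u₃ u₄ → InRibbon (u₁ , u₂) →
                  AdjMinusRibbon G a b u₁ u₄ × AdjMinusRibbon G a b u₂ u₃
  beside-ribbon c@(_ , _ , a₂₃ , _ , a₄₁) s =
    (adj-sym G a₄₁ , adjacent-sides c s) ,
    (a₂₃ , λ s₂₃ → adjacent-sides c s (s₂₃ ◅◅ (opp (rotate-4cycle G c) ◅ ε★)))

  Crossing : DEdge n → Set ℓ
  Crossing (x , y) = Linked a x × Linked b y × disp (x , y) ≈ D

  ribbon-crossing : ∀ {e} → InRibbon e → Crossing e ⊎ Crossing (swap e)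
  ribbon-crossing = reachable-induction (λ e → Crossing e ⊎ Crossing (swap e)) step
                                        (inj₁ (nil , nil , ≈-refl))
    where
      step : ∀ {e e′} → InRibbon e → RibbonStep G e e′ →
             Crossing e ⊎ Crossing (swap e) → Crossing e′ ⊎ Crossing (swap e′)
      step _ flip (inj₁ k) = inj₂ k
      step _ flip (inj₂ k) = inj₁ k
      step s (opp c) (inj₁ (au₁ , bu₂ , p)) with beside-ribbon c s
      ... | e₁₄ , e₂₃ = inj₁ (au₁ ▸ e₁₄ , bu₂ ▸ e₂₃ , ≈-trans (≈-sym (parallelogram c)) p)
      step s (opp c) (inj₂ (au₂ , bu₁ , p)) with beside-ribbon c s
      ... | e₁₄ , e₂₃ = inj₂ (au₂ ▸ e₂₃ , bu₁ ▸ e₁₄ , ≈-trans (≈-sym (parallelogram-swap c)) p)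

  -- if a and b stayed linked, every edge of G could be bypassed ...
  bypass : Linked a b → ∀ {x y} → Adj G x y → Linked x y
  bypass ab-linked {x} {y} xy with sameRibbon? G (a , b) (x , y)
  ... | no ∉ = cons (xy , ∉) nil
  ... | yes s with ribbon-crossing s
  ...   | inj₁ (ax , by , _) = linked-sym ax ++ʷ (ab-linked ++ʷ by)
  ...   | inj₂ (ay , bx , _) = linked-sym bx ++ʷ (linked-sym ab-linked ++ʷ ay)

  -- ... so the ribbon would not be an edge cut
  separated : ¬ Linked a b
  separated ab-linked with proj₂ cutting a b ab
  ... | x , y , ¬xy = ¬xy (expandʷ (bypass ab-linked) (proj₁ cutting x y))

  Side : Fin n → Set
  Side x = Linked a x ⊎ Linked b x

  side : ∀ x → Side x
  side x = transportʷ Side step (proj₁ cutting a x) (inj₁ nil)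
    where
      step : ∀ {p w} → Adj G p w → Side p → Side w
      step {p} {w} pw sp with sameRibbon? G (a , b) (p , w)
      step pw sp | yes s with ribbon-crossing s
      ... | inj₁ (_ , bw , _) = inj₂ bw
      ... | inj₂ (aw , _ , _) = inj₁ aw
      step pw (inj₁ ap) | no ∉ = inj₁ (ap ▸ (pw , ∉))
      step pw (inj₂ bp) | no ∉ = inj₂ (bp ▸ (pw , ∉))

  φ : Fin n → Pt A
  φ x with side x
  ... | inj₁ _ = ρ a
  ... | inj₂ _ = ρ b

  φ-a : ∀ {x} → Linked a x → φ x ≈ ρ a
  φ-a {x} ax with side x
  ... | inj₁ _  = ≈-refl
  ... | inj₂ bx = ⊥-elim (separated (ax ++ʷ linked-sym bx))

  φ-b : ∀ {x} → Linked b x → φ x ≈ ρ b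
  φ-b {x} bx with side x
  ... | inj₁ ax = ⊥-elim (separated (ax ++ʷ linked-sym bx))
  ... | inj₂ _  = ≈-refl

  φ-constant : ∀ {x y} → AdjMinusRibbon G a b x y → φ x ≈ φ y
  φ-constant {x} xy with side x
  ... | inj₁ ax = ≈-sym (φ-a (ax ▸ xy))
  ... | inj₂ bx = ≈-sym (φ-b (bx ▸ xy))

  φ-increment : ∀ {x y} → InRibbon (x , y) → disp (x , y) ≈ φ y ∙ φ x ⁻¹
  φ-increment s with ribbon-crossing s
  ... | inj₁ (ax , by , p) = ≈-trans p (≈-sym (∙-cong (φ-b by) (⁻¹-cong (φ-a ax))))
  ... | inj₂ (ay , bx , p) =
    ≈-trans (difference-swap p) (≈-sym (∙-cong (φ-a ay) (⁻¹-cong (φ-b bx))))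

  inRibbon-step : ∀ {e e′} → RibbonStep G e e′ → inRibbon? e ≡ inRibbon? e′
  inRibbon-step {e} {e′} st with sameRibbon? G (a , b) e | sameRibbon? G (a , b) e′
  ... | yes _ | yes _  = refl
  ... | no _  | no _   = refl
  ... | yes s | no ∉   = ⊥-elim (∉ (s ◅◅ (st ◅ ε★)))
  ... | no ∉  | yes s′ = ⊥-elim (∉ (s′ ◅◅ (ribbonStep-sym G st ◅ ε★)))

  inRibbon-ab : inRibbon? (a , b) ≡ true
  inRibbon-ab with sameRibbon? G (a , b) (a , b)
  ... | yes _ = refl
  ... | no ∉  = ⊥-elim (∉ ε★)

  ribbonSum : ∀ {u v} (W : Walk (Adj G) u v) → sumWhere inRibbon? (dedges W) ≈ φ v ∙ φ u ⁻¹
  ribbonSum = sumWhere-telescopes inRibbon? φ increment constant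
    where
      increment : ∀ {x y} → Adj G x y → inRibbon? (x , y) ≡ true → disp (x , y) ≈ φ y ∙ φ x ⁻¹
      increment {x} {y} _ r with sameRibbon? G (a , b) (x , y)
      ... | yes s = φ-increment s
      constant : ∀ {x y} → Adj G x y → inRibbon? (x , y) ≡ false → φ x ≈ φ y
      constant {x} {y} xy r with sameRibbon? G (a , b) (x , y)
      ... | no ∉ = φ-constant (xy , ∉)

-- In a P-framework, for every union of ribbons the sum of displacements over
-- its edges along a walk depends only on the endpoints: peel off one ribbon,
-- whose contribution is a potential difference, and recurse on the rest.
module UnionsOfRibbons {a ℓ : Level} (A : AbelianGroup a ℓ) {n : ℕ} (G : Graph n)
                       (ρ : Fin n → Pt A) (cutting : RibbonCutting G)
                       (placement : ParallelogramPlacement A G ρ) where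

  open AbelianGroup (abelianGroup A A)
    renaming (refl to ≈-refl; sym to ≈-sym; trans to ≈-trans)
  open EdgeSums A ρ
  open import Relation.Binary.Reasoning.Setoid setoid

  module Peel (f : DEdge n → Bool) (closed : RibbonClosed G f)
              (a b : Fin n) (ab : Adj G a b) (fab : f (a , b) ≡ true) where
    open Ribbon A G ρ cutting placement a b ab public

    rest : DEdge n → Bool
    rest e = f e ∧ not (inRibbon? e)

    ribbon⊆f : ∀ e → inRibbon? e ≡ true → f e ≡ true
    ribbon⊆f e r with sameRibbon? G (a , b) e
    ... | yes s = ≡-trans (≡-sym (closed-along G closed ab s)) fab

    rest⊆f : ∀ e → rest e ≡ true → f e ≡ true
    rest⊆f e r with f e
    ... | true = refl

    rest-closed : RibbonClosed G rest
    rest-closed e-edge st = cong₂ (λ x y → x ∧ not y) (closed e-edge st) (inRibbon-step st)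

    rest-smaller : count rest (pairs G) < count f (pairs G)
    rest-smaller = count-strict f rest rest⊆f (∈-pairs G (a , b)) fab rest-ab
      where
        rest-ab : rest (a , b) ≡ false
        rest-ab rewrite fab | inRibbon-ab = refl

    peel : ∀ {u v} (W : Walk (Adj G) u v) →
           sumWhere f (dedges W) ≈ (φ v ∙ φ u ⁻¹) ∙ sumWhere rest (dedges W)
    peel W = ≈-trans (sumWhere-split f inRibbon? ribbon⊆f (dedges W)) (∙-congʳ (ribbonSum W))

  selects-edge? : (f : DEdge n → Bool) → Dec (∃[ x ] ∃[ y ] Adj G x y × f (x , y) ≡ true)
  selects-edge? f = Fin.any? λ x → Fin.any? λ y → adj? G x y ×-dec (f (x , y) ≟ᵇ true)

  -- induction on the number of selected pairs
  walk-independent : ∀ k f → count f (pairs G) < k → RibbonClosed G f →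
                     ∀ {u v} (W W′ : Walk (Adj G) u v) →
                     sumWhere f (dedges W) ≈ sumWhere f (dedges W′)
  walk-independent (suc k) f bound closed {u} {v} W W′ with selects-edge? f
  ... | yes (a , b , ab , fab) = let open Peel f closed a b ab fab in begin
    sumWhere f (dedges W)                      ≈⟨ peel W ⟩
    (φ v ∙ φ u ⁻¹) ∙ sumWhere rest (dedges W)  ≈⟨ ∙-congˡ (walk-independent k rest
                                                    (<-≤-trans rest-smaller (≤-pred bound))
                                                    rest-closed W W′) ⟩
    (φ v ∙ φ u ⁻¹) ∙ sumWhere rest (dedges W′) ≈⟨ ≈-sym (peel W′) ⟩
    sumWhere f (dedges W′)                     ∎
  ... | no none = ≈-trans (vanishes W) (≈-sym (vanishes W′))
    where
      vanishes : (X : Walk (Adj G) u v) → sumWhere f (dedges X) ≈ ε ∙ ε ⁻¹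
      vanishes = sumWhere-telescopes f (λ _ → ε)
                   (λ xy fxy → ⊥-elim (none (_ , _ , xy , fxy))) (λ _ _ → ≈-refl)

  union-of-ribbons : ∀ f → RibbonClosed G f → ∀ {u v} (W W′ : Walk (Adj G) u v) →
                     sumWhere f (dedges W) ≈ sumWhere f (dedges W′)
  union-of-ribbons f = walk-independent (suc (count f (pairs G))) f (n<1+n _)

countColor-colours : ∀ {n} (δ : Fin n → Fin n → Color) c es →
                     countColor δ c es ≡ count (_==ᶜ c) (map (λ (x , y) → δ x y) es)
countColor-colours δ c []             = refl
countColor-colours δ c ((x , y) ∷ es) with δ x y ==ᶜ c
... | true  = cong suc (countColor-colours δ c es)
... | false = countColor-colours δ c es

two-and-two : ∀ c₁ c₂ c₃ c₄ →
              2 ≤ count (_==ᶜ red) (c₁ ∷ c₂ ∷ c₃ ∷ c₄ ∷ []) →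
              2 ≤ count (_==ᶜ blue) (c₁ ∷ c₂ ∷ c₃ ∷ c₄ ∷ []) →
              c₁ ≡ c₃ ⊎ (c₂ ≡ c₁ × c₄ ≡ c₃) ⊎ (c₄ ≡ c₁ × c₂ ≡ c₃)
two-and-two red  _    red  _    _ _ = inj₁ refl
two-and-two blue _    blue _    _ _ = inj₁ refl
two-and-two red  red  blue blue _ _ = inj₂ (inj₁ (refl , refl))
two-and-two blue blue red  red  _ _ = inj₂ (inj₁ (refl , refl))
two-and-two red  blue blue red  _ _ = inj₂ (inj₂ (refl , refl))
two-and-two blue red  red  blue _ _ = inj₂ (inj₂ (refl , refl))
two-and-two red  red  blue red  _ (s≤s ())
two-and-two red  blue blue blue (s≤s ()) _
two-and-two blue blue red  blue (s≤s ()) _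
two-and-two blue red  red  red  _ (s≤s ())

module CartesianNAC {n : ℕ} (G : Graph n) (δ : EdgeColoring G)
                    (nac : IsNAC G δ) (cartesian : IsCartesian G δ) where

  -- two vertices joined by a monochromatic 2-path of each of two colours:
  -- the colours agree, since no pair is joined by both a red and a blue path
  corner-colours : ∀ {x m m′ y c c′} → Unique (x ∷ m ∷ y ∷ []) → Unique (x ∷ m′ ∷ y ∷ []) →
                   AdjCol G δ c x m → AdjCol G δ c m y →
                   AdjCol G δ c′ x m′ → AdjCol G δ c′ m′ y → c ≡ c′
  corner-colours {c = red}  {red}  _ _ _ _ _ _ = refl
  corner-colours {c = blue} {blue} _ _ _ _ _ _ = refl
  corner-colours {x} {y = y} {red} {blue} U@((_ ∷ x≢y ∷ []) ∷ _) U′ xm my xm′ m′y =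
    ⊥-elim (cartesian x y x≢y ((cons xm (cons my nil) , U) , (cons xm′ (cons m′y nil) , U′)))
  corner-colours {x} {y = y} {blue} {red} U@((_ ∷ x≢y ∷ []) ∷ _) U′ xm my xm′ m′y =
    ⊥-elim (cartesian x y x≢y ((cons xm′ (cons m′y nil) , U′) , (cons xm (cons my nil) , U)))

  distinct₃ : ∀ {x y z : Fin n} → x ≢ y → x ≢ z → y ≢ z → Unique (x ∷ y ∷ z ∷ [])
  distinct₃ x≢y x≢z y≢z = (x≢y ∷ x≢z ∷ []) ∷ (y≢z ∷ []) ∷ [] ∷ []

  -- opposite sides of a 4-cycle have the same colour: otherwise the NAC
  -- condition forces two monochromatic corners of different colours
  opposite-sides : ∀ {u₁ u₂ u₃ u₄} → Is4Cycle G u₁ u₂ u₃ u₄ → col δ u₁ u₂ ≡ col δ u₃ u₄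
  opposite-sides {u₁} {u₂} {u₃} {u₄}
    (U@((n₁₂ ∷ n₁₃ ∷ n₁₄ ∷ []) ∷ (n₂₃ ∷ n₂₄ ∷ []) ∷ (n₃₄ ∷ []) ∷ [] ∷ []) , a₁₂ , a₂₃ , a₃₄ , a₄₁)
    with proj₂ (proj₂ nac) (u₁ ∷ u₂ ∷ u₃ ∷ u₄ ∷ [])
           (s≤s (s≤s (s≤s z≤n)) , U , a₁₂ ∷ a₂₃ ∷ a₃₄ ∷ a₄₁ ∷ [])
  ... | inj₁ (_ , (c₁ ∷ _ ∷ c₃ ∷ _ ∷ [])) = ≡-trans c₁ (≡-sym c₃)
  ... | inj₂ (reds , blues)
    with two-and-two (col δ u₁ u₂) (col δ u₂ u₃) (col δ u₃ u₄) (col δ u₄ u₁)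
           (subst (2 ≤_) (countColor-colours (col δ) red _) reds)
           (subst (2 ≤_) (countColor-colours (col δ) blue _) blues)
  ... | inj₁ c₁≡c₃ = c₁≡c₃
  ... | inj₂ (inj₁ (c₂≡c₁ , c₄≡c₃)) =
    corner-colours (distinct₃ n₁₂ n₁₃ n₂₃) (distinct₃ n₁₄ n₁₃ (≢-sym n₃₄))
      (a₁₂ , refl) (a₂₃ , c₂≡c₁)
      (adj-sym G a₄₁ , ≡-trans (colSym δ u₁ u₄ (adj-sym G a₄₁)) c₄≡c₃)
      (adj-sym G a₃₄ , colSym δ u₄ u₃ (adj-sym G a₃₄))
  ... | inj₂ (inj₂ (c₄≡c₁ , c₂≡c₃)) =
    corner-colours (distinct₃ (≢-sym n₁₂) n₂₄ n₁₄) (distinct₃ n₂₃ n₂₄ n₃₄)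
      (adj-sym G a₁₂ , colSym δ u₂ u₁ (adj-sym G a₁₂))
      (adj-sym G a₄₁ , ≡-trans (colSym δ u₁ u₄ (adj-sym G a₄₁)) c₄≡c₁)
      (a₂₃ , c₂≡c₃) (a₃₄ , refl)

  colourClass : Color → DEdge n → Bool
  colourClass c (x , y) = col δ x y ==ᶜ c

  colourClass-closed : ∀ c → RibbonClosed G (colourClass c)
  colourClass-closed c {x , y} xy flip = cong (_==ᶜ c) (colSym δ x y xy)
  colourClass-closed c _ (opp {u3 = u₃} {u4 = u₄} cyc@(_ , _ , _ , a₃₄ , _)) =
    cong (_==ᶜ c) (≡-trans (opposite-sides cyc) (colSym δ u₃ u₄ a₃₄))

lemma4p3 : ∀ {a ℓ : Level} (A : AbelianGroup a ℓ) {n : ℕ} (G : Graph n)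
             (ρ : Fin n → Pt A) →
             RibbonCutting G → ParallelogramPlacement A G ρ →
             (u v : Fin n) (W W' : Walk (Adj G) u v) →
             (δ : EdgeColoring G) → IsNAC G δ → IsCartesian G δ →
             (c : Color) →
             _≋_ A (colSum A ρ (col δ) c (dedges W)) (colSum A ρ (col δ) c (dedges W'))
lemma4p3 A G ρ cutting placement u v W W' δ nac cartesian c = begin
  colSum A ρ (col δ) c (dedges W)  ≡⟨ colSum-sumWhere (col δ) c (dedges W) ⟩
  sumWhere (colourClass c) (dedges W)
    ≈⟨ union-of-ribbons (colourClass c) (colourClass-closed c) W W' ⟩
  sumWhere (colourClass c) (dedges W') ≡⟨ colSum-sumWhere (col δ) c (dedges W') ⟨
  colSum A ρ (col δ) c (dedges W') ∎
  where
    open AbelianGroup (abelianGroup A A) using (setoid)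
    open import Relation.Binary.Reasoning.Setoid setoid
    open EdgeSums A ρ
    open UnionsOfRibbons A G ρ cutting placement
    open CartesianNAC G δ nac cartesian
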